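{- Let $\rho\subset\mathbb{Z}_+^d$ be the shape of some $d$-dimensional partition, let $A=(a_{\mathbf{i}})\in\mathcal{M}(\rho,\infty)$ and $\pi=\Phi(A)$. Then the following are equivalent: (a) $a_{\mathbf{i}}>0$ for all $\mathbf{i}\in\mathrm{Cr}(\rho)$; (b) $\mathrm{sh}(\pi)=\rho$.
   Context: A $d$-dimensional $\mathbb{N}$-matrix is an array $A=(a_{\mathbf{i}})_{\mathbf{i}\in\mathbb{Z}_+^d}$ of nonnegative integers with finitely many nonzero entries; a $d$-dimensional partition is such an array weakly decreasing in each coordinate; its shape is $\mathrm{sh}(\pi)=\{\mathbf{i}:\pi_{\mathbf{i}}>0\}$. A shape of a $d$-dimensional partition is a finite downward-closed subset of $\mathbb{Z}_+^d$. $\Phi(A)=G$ with $G_{\mathbf{i}}=\max_\Pi\sum_{\mathbf{j}\in\Pi}a_{\mathbf{j}}$ over directed lattice paths (steps $\mathbf{i}\to\mathbf{i}+\mathbf{e}_\ell$, $\ell\in[d]$) starting at $\mathbf{i}$. $\mathcal{M}(\rho,\infty)$ is the set of $d$-dimensional $\mathbb{N}$-matrices $A$ with $a_{\mathbf{i}}>0\Rightarrow\mathbf{i}\in\rho$. $\mathrm{Cr}(\rho)=\{\mathbf{i}\in\rho:\mathbf{i}+\mathbf{e}_\ell\notin\rho\ \forall\ell\in[d]\}$. -}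

module Defs where

open import Data.Nat using (ℕ; zero; suc; _+_; _≤_; _<_)
open import Data.Fin using (Fin)
open import Data.Vec using (Vec; updateAt)
open import Data.List using (List; []; _∷_)
open import Data.List.Membership.Propositional using (_∈_)
open import Data.Product using (Σ; ∃; _×_)
open import Relation.Nullary using (¬_)
open import Function.Bundles using (_⇔_)
open import Relation.Binary.PropositionalEquality using (_≡_)

-- Lattice points of ℤ₊^d, encoded 0-based as vectors of naturals.
Index : ℕ → Set
Index d = Vec ℕ d

step : ∀ {d} → Index d → Fin d → Index d
step i ℓ = updateAt i ℓ suc

Array : ℕ → Set
Array d = Index d → ℕ

FinitelySupported : ∀ {d} → Array d → Set
FinitelySupported {d} a = Σ (List (Index d)) λ L → ∀ i → 0 < a i → i ∈ L

IsNMatrix : ∀ {d} → Array d → Set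
IsNMatrix a = FinitelySupported a

IsPartition : ∀ {d} → Array d → Set
IsPartition {d} σ = IsNMatrix σ × (∀ (i : Index d) (ℓ : Fin d) → σ (step i ℓ) ≤ σ i)

_≐_ : ∀ {d} → (Index d → Set) → (Index d → Set) → Set
_≐_ {d} P Q = ∀ (i : Index d) → P i ⇔ Q i

sh : ∀ {d} → Array d → Index d → Set
sh π i = 0 < π i

IsPartitionShape : ∀ {d} → (Index d → Set) → Set
IsPartitionShape {d} ρ = Σ (Array d) λ σ → IsPartition σ × (sh σ ≐ ρ)

InM∞ : ∀ {d} → (Index d → Set) → Array d → Set
InM∞ ρ a = IsNMatrix a × (∀ i → 0 < a i → ρ i)

-- a directed lattice path starting at i, given by its sequence of unit steps;
-- pathSum a i p = sum of a over all lattice points visited (including i)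
pathSum : ∀ {d} → Array d → Index d → List (Fin d) → ℕ
pathSum a i []      = a i
pathSum a i (ℓ ∷ p) = a i + pathSum a (step i ℓ) p

IsΦ : ∀ {d} → Array d → Array d → Set
IsΦ {d} a G = ∀ (i : Index d) →
  (∀ (p : List (Fin d)) → pathSum a i p ≤ G i) × ∃ (λ p → pathSum a i p ≡ G i)

Cr : ∀ {d} → (Index d → Set) → Index d → Set
Cr ρ i = ρ i × (∀ ℓ → ¬ ρ (step i ℓ))

{-# OPTIONS --safe #-}
-- A positive path sum forces its starting point into ρ, because A is supported in ρ and
-- ρ is downward closed; so sh π ⊆ ρ always. Conversely every point of the finite shape ρ
-- reaches a corner by a directed path inside ρ, and when A is positive at that corner the
-- path has positive sum, so π is positive at the start. At a corner i every path leaves ρ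
-- after its first point, whence π_i = A_i; this gives (b) ⇒ (a).
module Submission where

open import Defs
open import Data.Nat using (ℕ; zero; suc; _+_; _≤_; _<_; z<s; _<?_)
open import Data.Nat.Properties
  using (+-suc; +-identityʳ; m≤n+m; <⇒≱; ≮⇒≥; n≤0⇒n≡0; ≤-refl; ≤-trans; <-≤-trans)
open import Data.Fin using (Fin)
import Data.Fin as Fin
open import Data.Fin.Properties using (any?)
open import Data.Vec using (_∷_; sum)
open import Data.List using (List; []; _∷_; map)
open import Data.List.Membership.Propositional using (_∈_)
open import Data.List.Extrema.Nat using (max; xs≤max)
open import Data.List.Membership.Propositional.Properties using (∈-map⁺)
import Data.List.Relation.Unary.All as All
open import Data.Product using (∃; _,_; proj₁; proj₂)
open import Data.Empty using (⊥-elim)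
open import Function using (_∘_)
open import Function.Bundles using (_⇔_; mk⇔; Equivalence)
open import Relation.Nullary using (yes; no)
import Relation.Nullary.Decidable as Dec
open import Relation.Unary using (Decidable)
open import Relation.Binary.PropositionalEquality
  using (_≡_; refl; sym; trans; cong; subst; module ≡-Reasoning)

DownClosed : ∀ {d} → (Index d → Set) → Set
DownClosed {d} ρ = ∀ (i : Index d) ℓ → ρ (step i ℓ) → ρ i

height : ∀ {d} → Index d → ℕ
height = sum

height-step : ∀ {d} (i : Index d) ℓ → height (step i ℓ) ≡ suc (height i)
height-step (x ∷ i) Fin.zero    = refl
height-step (x ∷ i) (Fin.suc ℓ) = trans (cong (x +_) (height-step i ℓ)) (+-suc x (height i))

Bounded : ∀ {d} → (Index d → Set) → Set
Bounded {d} ρ = ∃ λ B → ∀ (i : Index d) → ρ i → height i ≤ B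

end : ∀ {d} → Index d → List (Fin d) → Index d
end i []      = i
end i (ℓ ∷ p) = end (step i ℓ) p

pathSum-end : ∀ {d} (a : Array d) i p → a (end i p) ≤ pathSum a i p
pathSum-end a i []      = ≤-refl
pathSum-end a i (ℓ ∷ p) = ≤-trans (pathSum-end a (step i ℓ) p) (m≤n+m _ (a i))

module PathSums {d} {ρ : Index d → Set} (down : DownClosed ρ)
                {a : Array d} (supp : ∀ i → 0 < a i → ρ i) where

  pathSum-pos⇒∈ : ∀ i p → 0 < pathSum a i p → ρ i
  pathSum-pos⇒∈ i []      h = supp i h
  pathSum-pos⇒∈ i (ℓ ∷ p) h with a i in eq
  ... | zero  = down i ℓ (pathSum-pos⇒∈ (step i ℓ) p h)
  ... | suc _ = supp i (subst (0 <_) (sym eq) z<s)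

  pathSum-corner : ∀ {i} → Cr ρ i → ∀ p → pathSum a i p ≡ a i
  pathSum-corner     _         []      = refl
  pathSum-corner {i} (_ , out) (ℓ ∷ p) = begin
    a i + pathSum a (step i ℓ) p  ≡⟨ cong (a i +_) rest≡0 ⟩
    a i + 0                       ≡⟨ +-identityʳ (a i) ⟩
    a i                           ∎
    where
    open ≡-Reasoning
    rest≡0 : pathSum a (step i ℓ) p ≡ 0
    rest≡0 = n≤0⇒n≡0 (≮⇒≥ λ h → out ℓ (pathSum-pos⇒∈ (step i ℓ) p h))

reach-corner : ∀ {d} {ρ : Index d → Set} → Decidable ρ → Bounded ρ →
               ∀ i → ρ i → ∃ λ p → Cr ρ (end i p)
reach-corner {d} {ρ} ρ? (B , bounded) i ρi = climb (suc B) i (m≤n+m (suc B) (height i)) ρi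
  where
  -- k is fuel: each step raises the height, which stays ≤ B inside ρ.
  climb : ∀ k i → B < height i + k → ρ i → ∃ λ p → Cr ρ (end i p)
  climb k i lt ρi with any? (ρ? ∘ step i)
  ... | no stuck = [] , ρi , λ ℓ r → stuck (ℓ , r)
  climb zero i lt ρi | yes _ =
    ⊥-elim (<⇒≱ lt (subst (_≤ B) (sym (+-identityʳ (height i))) (bounded i ρi)))
  climb (suc k) i lt ρi | yes (ℓ , r) with climb k (step i ℓ) lt′ r
    where
    lt′ : B < height (step i ℓ) + k
    lt′ = subst (B <_) (trans (+-suc (height i) k) (cong (_+ k) (sym (height-step i ℓ)))) lt
  ... | p , c = ℓ ∷ p , c

module PartitionShape {d} {ρ : Index d → Set} (shape : IsPartitionShape ρ) where

  private
    σ : Array d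
    σ = proj₁ shape

    L : List (Index d)
    L = proj₁ (proj₁ (proj₁ (proj₂ shape)))

    finite : ∀ i → 0 < σ i → i ∈ L
    finite = proj₂ (proj₁ (proj₁ (proj₂ shape)))

    decreasing : ∀ i ℓ → σ (step i ℓ) ≤ σ i
    decreasing = proj₂ (proj₁ (proj₂ shape))

    shσ≐ρ : sh σ ≐ ρ
    shσ≐ρ = proj₂ (proj₂ shape)

    ρ⇒σ>0 : ∀ i → ρ i → 0 < σ i
    ρ⇒σ>0 i = Equivalence.from (shσ≐ρ i)

  downClosed : DownClosed ρ
  downClosed i ℓ r = Equivalence.to (shσ≐ρ i) (<-≤-trans (ρ⇒σ>0 _ r) (decreasing i ℓ))

  decidable : Decidable ρ
  decidable i = Dec.map (shσ≐ρ i) (0 <? σ i)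

  bounded : Bounded ρ
  bounded = max 0 (map height L) , λ i r →
    All.lookup (xs≤max 0 (map height L)) (∈-map⁺ height (finite i (ρ⇒σ>0 i r)))

lemma4p4 : (d : ℕ) (ρ : Index d → Set) → IsPartitionShape ρ →
    (A : Array d) → InM∞ ρ A → (π : Array d) → IsΦ A π →
    ((∀ i → Cr ρ i → 0 < A i) ⇔ (sh π ≐ ρ))
lemma4p4 d ρ shape A (_ , supp) π Φ = mk⇔ corners⇒shape shape⇒corners
  where
  open PartitionShape shape
  open PathSums downClosed supp

  sh⊆ρ : ∀ i → 0 < π i → ρ i
  sh⊆ρ i π>0 = let p , p-max = proj₂ (Φ i) in pathSum-pos⇒∈ i p (subst (0 <_) (sym p-max) π>0)

  corners⇒shape : (∀ i → Cr ρ i → 0 < A i) → sh π ≐ ρ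
  corners⇒shape A>0 i = mk⇔ (sh⊆ρ i) λ ρi →
    let p , c = reach-corner decidable bounded i ρi
    in <-≤-trans (<-≤-trans (A>0 _ c) (pathSum-end A i p)) (proj₁ (Φ i) p)

  shape⇒corners : sh π ≐ ρ → ∀ i → Cr ρ i → 0 < A i
  shape⇒corners sh≐ρ i c =
    let p , p-max = proj₂ (Φ i)
    in subst (0 <_) (trans (sym p-max) (pathSum-corner c p)) (Equivalence.from (sh≐ρ i) (proj₁ c))
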